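{- Let $c_1,c_2$ be positive integers, $n$ a nonzero integer, and $d=(c_1,c_2)$, and assume $d\mid n$. For $(x,y)\in X(c_1,c_2,n)$, let $r_1=(n\bar x-c_2)/c_1$, where $\bar x$ is an integer inverse of $x$ modulo $c_1$ (so $r_1$ is an integer whose class modulo $n$ depends only on the class of $(x,y)$). Then the map $i:(x,y)\mapsto r_1\bmod n$ is a bijection from $X(c_1,c_2,n)$ onto $Y(c_1,c_2,n)$.
   Context: $X(c_1,c_2,n)$ is a set of representatives of the equivalence classes of pairs $(x,y)\in\mathbb{Z}^2$ with $(x,c_1)=1$, $(y,c_2)=1$, $c_2x+c_1y=n$, where $(x,y)\sim(x',y')$ iff $x\equiv x'\pmod{c_1}$ and $y\equiv y'\pmod{c_2}$. $Y(c_1,c_2,n)$ is the set of classes $r\in(\mathbb{Z}/n\mathbb{Z})^*$ such that (a') $(c_1/d)r+(c_2/d)\equiv0\pmod{n/d}$, and (b') $(c_1/d)r+(c_2/d)\not\equiv 0\pmod{n/d'}$ for every divisor $d'$ of $d$ with $d'<d$. -}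

module Defs where

open import Data.Nat as ℕ using (ℕ; NonZero)
open import Data.Nat.Divisibility as ℕD using ()
open import Data.Nat.GCD as ℕG using (gcd[m,n]≢0)
open import Data.Integer using (ℤ; +_; _+_; _-_; _*_; _/ℕ_; 0ℤ; 1ℤ)
open import Data.Integer.Divisibility using (_∣_)
open import Data.Integer.GCD using (gcd)
open import Data.Product using (_×_)
open import Data.Sum using (inj₁)
open import Relation.Binary.PropositionalEquality using (_≡_)
open import Relation.Nullary using (¬_)

Cong : ℤ → ℤ → ℤ → Set
Cong a b m = m ∣ (a - b)

-- the pairs (x , y) whose classes make up X(c1,c2,n)
InX : ℕ → ℕ → ℤ → ℤ → ℤ → Set
InX c1 c2 n x y = (gcd x (+ c1) ≡ 1ℤ) × (gcd y (+ c2) ≡ 1ℤ) × ((+ c2) * x + (+ c1) * y ≡ n)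

XEquiv : ℕ → ℕ → ℤ → ℤ → ℤ → ℤ → Set
XEquiv c1 c2 x y x' y' = Cong x x' (+ c1) × Cong y y' (+ c2)

IsInvMod : ℕ → ℤ → ℤ → Set
IsInvMod c1 x xbar = Cong (x * xbar) 1ℤ (+ c1)

-- r1 = (n xbar - c2) / c1 , i.e. r1 is the (unique, as c1 > 0) integer with c1 r1 = n xbar - c2
IsR1 : ℕ → ℕ → ℤ → ℤ → ℤ → Set
IsR1 c1 c2 n xbar r1 = (+ c1) * r1 ≡ n * xbar - + c2

gcdNonZero : (c1 c2 : ℕ) → .{{NonZero c1}} → NonZero (ℕG.gcd c1 c2)
gcdNonZero c1 c2 {{nz}} = ℕ.≢-nonZero (gcd[m,n]≢0 c1 c2 (inj₁ (ℕ.≢-nonZero⁻¹ c1 {{nz}})))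

InY : (c1 c2 : ℕ) → .{{NonZero c1}} → ℤ → ℤ → Set
InY c1 c2 n r =
  (gcd r n ≡ 1ℤ)
  × Cong ((+ (c1 ℕ./ d)) * r + + (c2 ℕ./ d)) 0ℤ (n /ℕ d)
  × ((d' : ℕ) → .{{_ : NonZero d'}} → d' ℕD.∣ d → d' ℕ.< d →
       ¬ Cong ((+ (c1 ℕ./ d)) * r + + (c2 ℕ./ d)) 0ℤ (n /ℕ d'))
  where
  d : ℕ
  d = ℕG.gcd c1 c2
  instance
    dNZ : NonZero d
    dNZ = gcdNonZero c1 c2

{-# OPTIONS --safe #-}

-- Write c1 = A d, c2 = B d and n = m d. Dividing the relation c1 r + c2 = n x̄ defining r = r1 by d
-- gives A r + B = m x̄, which is condition (a′); condition (b′) at the divisor d′ = d/e says e ∤ x̄,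
-- so (b′) means that x̄ is prime to d, equivalently (given the relation) to c1. Everything else is
-- read off the relation: x̄ is an inverse of x mod c1, so the classes of x mod c1, of x̄ mod c1 and
-- of r mod n determine each other (c1 (r - r′) = n (x̄ - x̄′)); y = r x - n t where x x̄ - 1 = t c1;
-- and (r, n), (y, c2) are integer combinations of each other, so gcd(r, n) = 1 iff gcd(y, c2) = 1.
-- Conversely, an r in Y gives x̄ by (a′), x by inverting x̄ mod c1, and y by the formula above.
module Submission where

open import Defs
open import Data.Nat using (ℕ; NonZero)
open import Data.Nat.GCD using (gcd)
open import Data.Integer using (ℤ; +_)
open import Data.Integer.Divisibility using (_∣_)
open import Data.Product using (_×_; Σ-syntax)

open import Data.Empty using (⊥-elim)
open import Data.Integer using (-[1+_]; _+_; _-_; _*_; -_; 0ℤ; 1ℤ; ∣_∣; _/ℕ_; _%ℕ_)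
import Data.Integer as ℤ
open import Data.Integer.Coprimality using (Coprime)
open import Data.Integer.DivMod using (a≡a%ℕn+[a/ℕn]*n; n%ℕd<d)
open import Data.Integer.Divisibility.Signed as Signed
  using (divides; ∣ᵤ⇒∣; ∣⇒∣ᵤ; ∣-refl; ∣-trans; ∣m∣n⇒∣m+n; ∣m∣n⇒∣m-n; ∣m⇒∣m*n; ∣n⇒∣m*n)
  renaming (_∣_ to _∣ₛ_)
import Data.Integer.GCD as ℤ
import Data.Integer.Properties as ℤP
open import Data.Integer.Tactic.RingSolver using (solve)
open import Data.List using (_∷_; [])
import Data.Nat as ℕ
import Data.Nat.Coprimality as ℕ
import Data.Nat.Divisibility as ℕ
import Data.Nat.DivMod as ℕ
import Data.Nat.GCD as ℕ
import Data.Nat.Properties as ℕP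
open import Data.Product using (_,_; proj₁; proj₂)
open import Function using (_∘_; _⇔_; mk⇔; Equivalence)
open import Relation.Binary.PropositionalEquality
  using (_≡_; refl; sym; trans; cong; cong₂; subst; subst₂; module ≡-Reasoning)
open import Relation.Nullary using (¬_)
open Equivalence using (to; from)
open ≡-Reasoning

gcd≡1⇒coprime : ∀ i j → ℤ.gcd i j ≡ 1ℤ → Coprime i j
gcd≡1⇒coprime i j = ℕ.gcd≡1⇒coprime {∣ i ∣} {∣ j ∣} ∘ ℤP.+-injective

coprime⇒gcd≡1 : ∀ i j → Coprime i j → ℤ.gcd i j ≡ 1ℤ
coprime⇒gcd≡1 i j = cong +_ ∘ ℕ.coprime⇒gcd≡1 {∣ i ∣} {∣ j ∣}

coprime-transfer : ∀ i j k l → (∀ {g} → g ∣ₛ i → g ∣ₛ j → g ∣ₛ k × g ∣ₛ l) →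
                   Coprime k l → Coprime i j
coprime-transfer i j k l common coprime {p} (p∣i , p∣j) with common {+ p} (∣ᵤ⇒∣ p∣i) (∣ᵤ⇒∣ p∣j)
... | p∣k , p∣l = coprime (∣⇒∣ᵤ p∣k , ∣⇒∣ᵤ p∣l)

invertible⇒coprime : ∀ c x x̄ → c ∣ₛ x * x̄ - 1ℤ → Coprime x c
invertible⇒coprime c x x̄ c∣xx̄-1 = coprime-transfer x c 1ℤ c common (ℕ.1-coprimeTo ∣ c ∣)
  where
  identity : x * x̄ - (x * x̄ - 1ℤ) ≡ 1ℤ
  identity = solve (x ∷ x̄ ∷ [])
  common : ∀ {g} → g ∣ₛ x → g ∣ₛ c → g ∣ₛ 1ℤ × g ∣ₛ c
  common {g} g∣x g∣c =
    subst (g ∣ₛ_) identity (∣m∣n⇒∣m-n (∣m⇒∣m*n x̄ g∣x) (∣-trans g∣c c∣xx̄-1)) , g∣c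

lift-Bézout : ∀ p q r s → 1 ℕ.+ p ℕ.* q ≡ r ℕ.* s → 1ℤ + + p * + q ≡ + r * + s
lift-Bézout p q r s eq = begin
  1ℤ + + p * + q     ≡⟨ cong (λ z → 1ℤ + z) (ℤP.pos-* p q) ⟨
  + (1 ℕ.+ p ℕ.* q)  ≡⟨ cong +_ eq ⟩
  + (r ℕ.* s)        ≡⟨ ℤP.pos-* r s ⟩
  + r * + s          ∎

bézout-inverse : ∀ a c → ℕ.Coprime a c → Σ[ x ∈ ℤ ] + c ∣ₛ x * + a - 1ℤ
bézout-inverse a c coprime with ℕ.coprime-Bézout coprime
... | ℕ.Bézout.+- x y eq = + x , divides (+ y) (inverse (+ y * + c) _ (lift-Bézout y c x a eq))
  where
  inverse : ∀ i j → 1ℤ + i ≡ j → j - 1ℤ ≡ i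
  inverse i _ refl = solve (i ∷ [])
... | ℕ.Bézout.-+ x y eq =
  - + x , divides (- + y) (negated-inverse (+ x) (+ a) (+ y) (+ c) (lift-Bézout x a y c eq))
  where
  negated-inverse : ∀ i k j l → 1ℤ + i * k ≡ j * l → - i * k - 1ℤ ≡ - j * l
  negated-inverse i k j l eq = begin
    - i * k - 1ℤ    ≡⟨ solve (i ∷ k ∷ []) ⟩
    - (1ℤ + i * k)  ≡⟨ cong -_ eq ⟩
    - (j * l)       ≡⟨ solve (j ∷ l ∷ []) ⟩
    - j * l         ∎

coprime⇒invertible : ∀ w c → Coprime w (+ c) → Σ[ x ∈ ℤ ] + c ∣ₛ x * w - 1ℤ
coprime⇒invertible (+ a)    c = bézout-inverse a c
coprime⇒invertible -[1+ a ] c coprime with bézout-inverse (ℕ.suc a) c coprime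
... | x , divides q eq = - x , divides q (trans (cong (_- 1ℤ) (neg*neg x (+ ℕ.suc a))) eq)
  where
  neg*neg : ∀ i j → - i * - j ≡ i * j
  neg*neg i j = solve (i ∷ j ∷ [])

inverse-comm : ∀ c x x̄ → c ∣ₛ x * x̄ - 1ℤ → c ∣ₛ x̄ * x - 1ℤ
inverse-comm c x x̄ = subst (λ z → c ∣ₛ z - 1ℤ) (ℤP.*-comm x x̄)

inverse-unique : ∀ c x x̄ x′ x̄′ → c ∣ₛ x * x̄ - 1ℤ → c ∣ₛ x′ * x̄′ - 1ℤ → c ∣ₛ x - x′ → c ∣ₛ x̄ - x̄′
inverse-unique c x x̄ x′ x̄′ inv inv′ x≡x′ = subst (c ∣ₛ_) identity
  (∣m∣n⇒∣m-n (∣m∣n⇒∣m-n (∣n⇒∣m*n x̄′ inv) (∣n⇒∣m*n x̄ inv′)) (∣n⇒∣m*n (x̄ * x̄′) x≡x′))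
  where
  identity : x̄′ * (x * x̄ - 1ℤ) - x̄ * (x′ * x̄′ - 1ℤ) - x̄ * x̄′ * (x - x′) ≡ x̄ - x̄′
  identity = solve (x ∷ x̄ ∷ x′ ∷ x̄′ ∷ [])

∣ₛ-transfer : ∀ j k u v .{{_ : ℤ.NonZero k}} → j * u ≡ k * v → k ∣ₛ u → j ∣ₛ v
∣ₛ-transfer j k u v ju≡kv k∣u =
  Signed.*-cancelˡ-∣ k (subst₂ _∣ₛ_ (ℤP.*-comm j k) ju≡kv (Signed.*-monoʳ-∣ j k∣u))

Cong-refl : ∀ i k → Cong i i k
Cong-refl i k = subst (∣ k ∣ ℕ.∣_) (cong ∣_∣ (sym (ℤP.+-inverseʳ i))) (∣ k ∣ ℕ.∣0)

Cong-sym : ∀ i j k → Cong i j k → Cong j i k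
Cong-sym i j k = subst (∣ k ∣ ℕ.∣_) (ℤP.∣i-j∣≡∣j-i∣ i j)

i*d/ℕd≡i : ∀ i d .{{_ : NonZero d}} → i * + d /ℕ d ≡ i
i*d/ℕd≡i i d = ℤP.*-cancelʳ-≡ q i (+ d) (sym (begin
  i * + d        ≡⟨ division ⟩
  + ρ + q * + d  ≡⟨ cong (λ ρ → + ρ + q * + d) ρ≡0 ⟩
  0ℤ + q * + d   ≡⟨ ℤP.+-identityˡ (q * + d) ⟩
  q * + d        ∎))
  where
  q = i * + d /ℕ d
  ρ = i * + d %ℕ d
  division : i * + d ≡ + ρ + q * + d
  division = a≡a%ℕn+[a/ℕn]*n (i * + d) d
  remainder : ∀ a b ρ q → a * b ≡ ρ + q * b → ρ ≡ (a - q) * b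
  remainder a b ρ q eq = begin
    ρ                  ≡⟨ solve (b ∷ ρ ∷ q ∷ []) ⟩
    ρ + q * b - q * b  ≡⟨ cong (_- q * b) (sym eq) ⟩
    a * b - q * b      ≡⟨ solve (a ∷ b ∷ q ∷ []) ⟩
    (a - q) * b        ∎
  <∧∣⇒≡0 : ∀ {ρ d} → ρ ℕ.< d → d ℕ.∣ ρ → ρ ≡ 0
  <∧∣⇒≡0 {ℕ.zero}  _   _   = refl
  <∧∣⇒≡0 {ℕ.suc _} ρ<d d∣ρ = ⊥-elim (ℕ.>⇒∤ ρ<d d∣ρ)
  ρ≡0 : ρ ≡ 0
  ρ≡0 = <∧∣⇒≡0 (n%ℕd<d (i * + d) d)
    (∣⇒∣ᵤ {+ d} {+ ρ} (divides (i - q) (remainder i (+ d) (+ ρ) q division)))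

i≡j-k⇔i+k≡j : ∀ i j k → i ≡ j - k ⇔ i + k ≡ j
i≡j-k⇔i+k≡j i j k = mk⇔ (λ { refl → solve (j ∷ k ∷ []) }) (λ { refl → solve (i ∷ k ∷ []) })

c₁∣n*x̄-c₂ : ∀ c₁ c₂ n x y x̄ → c₂ * x + c₁ * y ≡ n → c₁ ∣ₛ x * x̄ - 1ℤ → c₁ ∣ₛ n * x̄ - c₂
c₁∣n*x̄-c₂ c₁ c₂ _ x y x̄ refl inv =
  subst (c₁ ∣ₛ_) identity (∣m∣n⇒∣m+n (∣n⇒∣m*n c₂ inv) (∣m⇒∣m*n (y * x̄) ∣-refl))
  where
  identity : c₂ * (x * x̄ - 1ℤ) + c₁ * (y * x̄) ≡ (c₂ * x + c₁ * y) * x̄ - c₂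
  identity = solve (c₁ ∷ c₂ ∷ x ∷ y ∷ x̄ ∷ [])

r-diff : ∀ c₁ c₂ n r r′ x̄ x̄′ → c₁ * r + c₂ ≡ n * x̄ → c₁ * r′ + c₂ ≡ n * x̄′ →
         c₁ * (r - r′) ≡ n * (x̄ - x̄′)
r-diff c₁ c₂ n r r′ x̄ x̄′ R R′ = begin
  c₁ * (r - r′)                   ≡⟨ solve (c₁ ∷ c₂ ∷ r ∷ r′ ∷ []) ⟩
  (c₁ * r + c₂) - (c₁ * r′ + c₂)  ≡⟨ cong₂ _-_ R R′ ⟩
  n * x̄ - n * x̄′                  ≡⟨ solve (n ∷ x̄ ∷ x̄′ ∷ []) ⟩
  n * (x̄ - x̄′)                    ∎

y-diff : ∀ c₁ c₂ n x y x′ y′ → c₂ * x + c₁ * y ≡ n → c₂ * x′ + c₁ * y′ ≡ n →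
         c₂ * (x′ - x) ≡ c₁ * (y - y′)
y-diff c₁ c₂ n x y x′ y′ E E′ = begin
  c₂ * (x′ - x)                                           ≡⟨ solve (c₁ ∷ c₂ ∷ x ∷ y ∷ x′ ∷ y′ ∷ []) ⟩
  (c₂ * x′ + c₁ * y′) - (c₂ * x + c₁ * y) + c₁ * (y - y′) ≡⟨ cong₂ (λ u v → u - v + c₁ * (y - y′)) E′ E ⟩
  n - n + c₁ * (y - y′)                                   ≡⟨ solve (c₁ ∷ n ∷ y ∷ y′ ∷ []) ⟩
  c₁ * (y - y′)                                           ∎

rx-nt-solves : ∀ c₁ c₂ n x x̄ t r → x * x̄ - 1ℤ ≡ t * c₁ → c₁ * r + c₂ ≡ n * x̄ →
               c₂ * x + c₁ * (r * x - n * t) ≡ n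
rx-nt-solves c₁ c₂ n x x̄ t r I R = begin
  c₂ * x + c₁ * (r * x - n * t)     ≡⟨ solve (c₁ ∷ c₂ ∷ n ∷ x ∷ t ∷ r ∷ []) ⟩
  (c₁ * r + c₂) * x - n * (t * c₁)  ≡⟨ cong₂ (λ u v → u * x - n * v) R (sym I) ⟩
  n * x̄ * x - n * (x * x̄ - 1ℤ)      ≡⟨ solve (n ∷ x ∷ x̄ ∷ []) ⟩
  n                                 ∎

y≡rx-nt : ∀ c₁ c₂ n x y x̄ t r .{{_ : ℤ.NonZero c₁}} →
          x * x̄ - 1ℤ ≡ t * c₁ → c₁ * r + c₂ ≡ n * x̄ → c₂ * x + c₁ * y ≡ n → y ≡ r * x - n * t
y≡rx-nt c₁ c₂ n x y x̄ t r I R E = ℤP.*-cancelˡ-≡ c₁ y (r * x - n * t) (begin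
  c₁ * y                                              ≡⟨ solve (c₁ ∷ c₂ ∷ x ∷ y ∷ r ∷ []) ⟩
  (c₂ * x + c₁ * y) - (c₁ * r + c₂) * x + c₁ * r * x  ≡⟨ cong₂ (λ u v → u - v * x + c₁ * r * x) E R ⟩
  n - n * x̄ * x + c₁ * r * x                         ≡⟨ solve (c₁ ∷ n ∷ x ∷ x̄ ∷ r ∷ []) ⟩
  c₁ * (r * x) - n * (x * x̄ - 1ℤ)                     ≡⟨ cong (λ u → c₁ * (r * x) - n * u) I ⟩
  c₁ * (r * x) - n * (t * c₁)                         ≡⟨ solve (c₁ ∷ n ∷ x ∷ t ∷ r ∷ []) ⟩
  c₁ * (r * x - n * t)                                ∎)

n*x̄-c₁*r≡c₂ : ∀ c₁ c₂ n x̄ r → c₁ * r + c₂ ≡ n * x̄ → n * x̄ - c₁ * r ≡ c₂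
n*x̄-c₁*r≡c₂ c₁ c₂ n x̄ r R = begin
  n * x̄ - c₁ * r        ≡⟨ cong (_- c₁ * r) R ⟨
  c₁ * r + c₂ - c₁ * r  ≡⟨ solve (c₁ ∷ c₂ ∷ r ∷ []) ⟩
  c₂                    ∎

-- y = r x - n t and c₂ = n x̄ - c₁ r, while r = x̄ y + t c₂ and n = c₂ x + c₁ y.
coprime[r,n]⇔coprime[y,c₂] : ∀ c₁ c₂ n x x̄ t r → x * x̄ - 1ℤ ≡ t * c₁ → c₁ * r + c₂ ≡ n * x̄ →
                             Coprime r n ⇔ Coprime (r * x - n * t) c₂
coprime[r,n]⇔coprime[y,c₂] c₁ c₂ n x x̄ t r I R = mk⇔
  (coprime-transfer y c₂ r n λ g∣y g∣c₂ →
     subst (_ ∣ₛ_) r≡x̄y+tc₂ (∣m∣n⇒∣m+n (∣n⇒∣m*n x̄ g∣y) (∣n⇒∣m*n t g∣c₂)) ,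
     subst (_ ∣ₛ_) (rx-nt-solves c₁ c₂ n x x̄ t r I R) (∣m∣n⇒∣m+n (∣m⇒∣m*n x g∣c₂) (∣n⇒∣m*n c₁ g∣y)))
  (coprime-transfer r n y c₂ λ g∣r g∣n →
     ∣m∣n⇒∣m-n (∣m⇒∣m*n x g∣r) (∣m⇒∣m*n t g∣n) ,
     subst (_ ∣ₛ_) (n*x̄-c₁*r≡c₂ c₁ c₂ n x̄ r R) (∣m∣n⇒∣m-n (∣m⇒∣m*n x̄ g∣n) (∣n⇒∣m*n c₁ g∣r)))
  where
  y = r * x - n * t
  r≡x̄y+tc₂ : x̄ * y + t * c₂ ≡ r
  r≡x̄y+tc₂ = begin
    x̄ * (r * x - n * t) + t * c₂                 ≡⟨ solve (c₂ ∷ n ∷ x ∷ x̄ ∷ t ∷ r ∷ []) ⟩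
    r * (x * x̄ - 1ℤ) - t * (n * x̄) + t * c₂ + r  ≡⟨ cong₂ (λ u v → r * u - t * v + t * c₂ + r) I (sym R) ⟩
    r * (t * c₁) - t * (c₁ * r + c₂) + t * c₂ + r ≡⟨ solve (c₁ ∷ c₂ ∷ t ∷ r ∷ []) ⟩
    r                                            ∎

scaled-relation : ∀ c₁ c₂ n A B m d r w .{{_ : ℤ.NonZero d}} →
                  c₁ ≡ A * d → c₂ ≡ B * d → n ≡ m * d →
                  c₁ * r + c₂ ≡ n * w ⇔ A * r + B ≡ m * w
scaled-relation _ _ _ A B m d r w refl refl refl = mk⇔
  (λ eq → ℤP.*-cancelʳ-≡ (A * r + B) (m * w) d (begin
     (A * r + B) * d    ≡⟨ solve (A ∷ B ∷ d ∷ r ∷ []) ⟩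
     A * d * r + B * d  ≡⟨ eq ⟩
     m * d * w          ≡⟨ solve (m ∷ d ∷ w ∷ []) ⟩
     m * w * d          ∎))
  (λ eq → begin
     A * d * r + B * d  ≡⟨ solve (A ∷ B ∷ d ∷ r ∷ []) ⟩
     (A * r + B) * d    ≡⟨ cong (_* d) eq ⟩
     m * w * d          ≡⟨ solve (m ∷ d ∷ w ∷ []) ⟩
     m * d * w          ∎)

module Correspondence (c1 c2 : ℕ) .{{_ : NonZero c1}} .{{_ : NonZero c2}}
                      (n : ℤ) .{{_ : ℤ.NonZero n}} (d∣n : + gcd c1 c2 ∣ n) where

  d : ℕ
  d = gcd c1 c2

  instance
    d≢0 : NonZero d
    d≢0 = gcdNonZero c1 c2

  d∣ₛn : + d ∣ₛ n
  d∣ₛn = ∣ᵤ⇒∣ {+ d} {n} d∣n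

  A B m : ℤ
  A = + (c1 ℕ./ d)
  B = + (c2 ℕ./ d)
  m = Signed.quotient d∣ₛn

  n≡m*d : n ≡ m * + d
  n≡m*d = Signed._∣_.equality d∣ₛn

  instance
    m≢0 : ℤ.NonZero m
    m≢0 = ℤ.≢-nonZero {m} λ m≡0 → ℕ.≢-nonZero⁻¹ ∣ n ∣ (cong ∣_∣ (trans n≡m*d (cong (_* + d) m≡0)))

  c1≡A*d : + c1 ≡ A * + d
  c1≡A*d = trans (cong +_ (sym (ℕ.m/n*n≡m (ℕ.gcd[m,n]∣m c1 c2)))) (ℤP.pos-* (c1 ℕ./ d) d)

  c2≡B*d : + c2 ≡ B * + d
  c2≡B*d = trans (cong +_ (sym (ℕ.m/n*n≡m (ℕ.gcd[m,n]∣n c1 c2)))) (ℤP.pos-* (c2 ℕ./ d) d)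

  IsR1⇒c1*r+c2≡n*x̄ : ∀ x̄ r → IsR1 c1 c2 n x̄ r → + c1 * r + + c2 ≡ n * x̄
  IsR1⇒c1*r+c2≡n*x̄ x̄ r = to (i≡j-k⇔i+k≡j (+ c1 * r) (n * x̄) (+ c2))

  related⇔reduced : ∀ r w → + c1 * r + + c2 ≡ n * w ⇔ A * r + B ≡ m * w
  related⇔reduced r w = scaled-relation (+ c1) (+ c2) n A B m (+ d) r w c1≡A*d c2≡B*d n≡m*d

  n/d′≡m*e : ∀ d′ e .{{_ : NonZero d′}} → d ≡ e ℕ.* d′ → n /ℕ d′ ≡ m * + e
  n/d′≡m*e d′ e d≡ed′ = begin
    n /ℕ d′               ≡⟨ cong (_/ℕ d′) n≡m*e*d′ ⟩
    m * + e * + d′ /ℕ d′  ≡⟨ i*d/ℕd≡i (m * + e) d′ ⟩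
    m * + e               ∎
    where
    n≡m*e*d′ : n ≡ m * + e * + d′
    n≡m*e*d′ = begin
      n                 ≡⟨ n≡m*d ⟩
      m * + d           ≡⟨ cong (λ k → m * + k) d≡ed′ ⟩
      m * + (e ℕ.* d′)  ≡⟨ cong (m *_) (ℤP.pos-* e d′) ⟩
      m * (+ e * + d′)  ≡⟨ ℤP.*-assoc m (+ e) (+ d′) ⟨
      m * + e * + d′    ∎

  Cong-mod-n/d′⇔m*e∣ : ∀ z d′ e .{{_ : NonZero d′}} → d ≡ e ℕ.* d′ →
                       Cong z 0ℤ (n /ℕ d′) ⇔ m * + e ∣ₛ z
  Cong-mod-n/d′⇔m*e∣ z d′ e d≡ed′ = mk⇔
    (λ z≡0 → subst₂ _∣ₛ_ (n/d′≡m*e d′ e d≡ed′) (ℤP.+-identityʳ z) (∣ᵤ⇒∣ z≡0))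
    (λ me∣z → ∣⇒∣ᵤ (subst₂ _∣ₛ_ (sym (n/d′≡m*e d′ e d≡ed′)) (sym (ℤP.+-identityʳ z)) me∣z))

  Cong-mod-n/d⇔m∣ : ∀ z → Cong z 0ℤ (n /ℕ d) ⇔ m ∣ₛ z
  Cong-mod-n/d⇔m∣ z = subst (λ k → Cong z 0ℤ (n /ℕ d) ⇔ k ∣ₛ z) (ℤP.*-identityʳ m)
    (Cong-mod-n/d′⇔m*e∣ z d 1 (sym (ℕP.*-identityˡ d)))

  Cong-mod-n/d′⇔e∣w : ∀ z w d′ e .{{_ : NonZero d′}} → z ≡ m * w → d ≡ e ℕ.* d′ →
                      Cong z 0ℤ (n /ℕ d′) ⇔ + e ∣ₛ w
  Cong-mod-n/d′⇔e∣w _ w d′ e refl d≡ed′ = mk⇔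
    (Signed.*-cancelˡ-∣ m ∘ to (Cong-mod-n/d′⇔m*e∣ (m * w) d′ e d≡ed′))
    (from (Cong-mod-n/d′⇔m*e∣ (m * w) d′ e d≡ed′) ∘ Signed.*-monoʳ-∣ m)

  Minimal : ℤ → Set
  Minimal r = (d′ : ℕ) → .{{_ : NonZero d′}} → d′ ℕ.∣ d → d′ ℕ.< d → ¬ Cong (A * r + B) 0ℤ (n /ℕ d′)

  minimal⇔coprime : ∀ r w → A * r + B ≡ m * w → Minimal r ⇔ Coprime w (+ d)
  minimal⇔coprime r w reduced = mk⇔ minimal⇒coprime coprime⇒minimal
    where
    Cong⇔e∣w : ∀ d′ e .{{_ : NonZero d′}} → d ≡ e ℕ.* d′ → Cong (A * r + B) 0ℤ (n /ℕ d′) ⇔ + e ∣ₛ w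
    Cong⇔e∣w d′ e = Cong-mod-n/d′⇔e∣w (A * r + B) w d′ e reduced

    coprime⇒minimal : Coprime w (+ d) → Minimal r
    coprime⇒minimal coprime d′ (ℕ.divides e d≡ed′) d′<d cong-mod = ℕP.<-irrefl d′≡d d′<d
      where
      e≡1 : e ≡ 1
      e≡1 = coprime (∣⇒∣ᵤ (to (Cong⇔e∣w d′ e d≡ed′) cong-mod) , ℕ.divides d′ (trans d≡ed′ (ℕP.*-comm e d′)))
      d′≡d : d′ ≡ d
      d′≡d = sym (trans d≡ed′ (trans (cong (ℕ._* d′) e≡1) (ℕP.*-identityˡ d′)))

    minimal⇒coprime : Minimal r → Coprime w (+ d)
    minimal⇒coprime minimal {ℕ.zero} (_ , 0∣d) = ⊥-elim (ℕ.≢-nonZero⁻¹ d (ℕ.0∣⇒≡0 0∣d))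
    minimal⇒coprime minimal {1} _ = refl
    minimal⇒coprime minimal {k@(ℕ.suc (ℕ.suc _))} (k∣w , ℕ.divides e d≡ek) =
      ⊥-elim (minimal e {{e≢0}} (ℕ.divides k d≡ke) e<d (from (Cong⇔e∣w e k {{e≢0}} d≡ke) (∣ᵤ⇒∣ k∣w)))
      where
      d≡ke : d ≡ k ℕ.* e
      d≡ke = trans d≡ek (ℕP.*-comm e k)
      e≢0 : NonZero e
      e≢0 = ℕ.≢-nonZero λ e≡0 → ℕ.≢-nonZero⁻¹ d (trans d≡ek (cong (ℕ._* k) e≡0))
      e<d : e ℕ.< d
      e<d = subst (e ℕ.<_) (sym d≡ek) (ℕP.m<m*n e k {{e≢0}} (ℕ.s≤s (ℕ.s≤s ℕ.z≤n)))

  coprime[w,c1]⇒coprime[w,d] : ∀ w → Coprime w (+ c1) → Coprime w (+ d)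
  coprime[w,c1]⇒coprime[w,d] w = coprime-transfer w (+ d) w (+ c1)
    (λ g∣w g∣d → g∣w , ∣-trans g∣d (∣ᵤ⇒∣ {+ d} {+ c1} (ℕ.gcd[m,n]∣m c1 c2)))

  coprime[w,d]⇒coprime[w,c1] : ∀ r w → + c1 * r + + c2 ≡ n * w → Coprime w (+ d) → Coprime w (+ c1)
  coprime[w,d]⇒coprime[w,c1] r w R = coprime-transfer w (+ c1) w (+ d) λ {g} g∣w g∣c1 →
    let g∣c2 = subst (g ∣ₛ_) (n*x̄-c₁*r≡c₂ (+ c1) (+ c2) n w r R)
                 (∣m∣n⇒∣m-n (∣n⇒∣m*n n g∣w) (∣m⇒∣m*n r g∣c1))
    in g∣w , ∣ᵤ⇒∣ (ℤ.gcd-greatest {+ c1} {+ c2} {g} (∣⇒∣ᵤ g∣c1) (∣⇒∣ᵤ g∣c2))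

  r₁-exists : (x y x̄ : ℤ) → InX c1 c2 n x y → IsInvMod c1 x x̄ → Σ[ r₁ ∈ ℤ ] IsR1 c1 c2 n x̄ r₁
  r₁-exists x y x̄ (_ , _ , E) inv with c₁∣n*x̄-c₂ (+ c1) (+ c2) n x y x̄ E (∣ᵤ⇒∣ inv)
  ... | divides r₁ eq = r₁ , trans (ℤP.*-comm (+ c1) r₁) (sym eq)

  r₁-respects-~ : (x y x̄ r₁ x′ y′ x̄′ r₁′ : ℤ) →
                  InX c1 c2 n x y → IsInvMod c1 x x̄ → IsR1 c1 c2 n x̄ r₁ →
                  InX c1 c2 n x′ y′ → IsInvMod c1 x′ x̄′ → IsR1 c1 c2 n x̄′ r₁′ →
                  XEquiv c1 c2 x y x′ y′ → Cong r₁ r₁′ n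
  r₁-respects-~ x _ x̄ r x′ _ x̄′ r′ _ inv R _ inv′ R′ (x≡x′ , _) =
    ∣⇒∣ᵤ (∣ₛ-transfer n (+ c1) (x̄ - x̄′) (r - r′)
      (sym (r-diff (+ c1) (+ c2) n r r′ x̄ x̄′ (IsR1⇒c1*r+c2≡n*x̄ x̄ r R) (IsR1⇒c1*r+c2≡n*x̄ x̄′ r′ R′)))
      (inverse-unique (+ c1) x x̄ x′ x̄′ (∣ᵤ⇒∣ inv) (∣ᵤ⇒∣ inv′) (∣ᵤ⇒∣ x≡x′)))

  r₁∈Y : (x y x̄ r₁ : ℤ) → InX c1 c2 n x y → IsInvMod c1 x x̄ → IsR1 c1 c2 n x̄ r₁ → InY c1 c2 n r₁
  r₁∈Y x y x̄ r (_ , gcd[y,c2]≡1 , E) inv R with ∣ᵤ⇒∣ {+ c1} {x * x̄ - 1ℤ} inv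
  ... | divides t I =
    coprime⇒gcd≡1 r n coprime[r,n] ,
    from (Cong-mod-n/d⇔m∣ (A * r + B)) (divides x̄ (trans reduced (ℤP.*-comm m x̄))) ,
    from (minimal⇔coprime r x̄ reduced)
      (coprime[w,c1]⇒coprime[w,d] x̄ (invertible⇒coprime (+ c1) x̄ x (inverse-comm (+ c1) x x̄ (∣ᵤ⇒∣ inv))))
    where
    R⁺ : + c1 * r + + c2 ≡ n * x̄
    R⁺ = IsR1⇒c1*r+c2≡n*x̄ x̄ r R
    reduced : A * r + B ≡ m * x̄
    reduced = to (related⇔reduced r x̄) R⁺
    coprime[r,n] : Coprime r n
    coprime[r,n] = from (coprime[r,n]⇔coprime[y,c₂] (+ c1) (+ c2) n x x̄ t r I R⁺)
      (subst (λ z → Coprime z (+ c2)) (y≡rx-nt (+ c1) (+ c2) n x y x̄ t r I R⁺ E)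
        (gcd≡1⇒coprime y (+ c2) gcd[y,c2]≡1))

  r₁-injective : (x y x̄ r₁ x′ y′ x̄′ r₁′ : ℤ) →
                 InX c1 c2 n x y → IsInvMod c1 x x̄ → IsR1 c1 c2 n x̄ r₁ →
                 InX c1 c2 n x′ y′ → IsInvMod c1 x′ x̄′ → IsR1 c1 c2 n x̄′ r₁′ →
                 Cong r₁ r₁′ n → XEquiv c1 c2 x y x′ y′
  r₁-injective x y x̄ r x′ y′ x̄′ r′ (_ , _ , E) inv R (_ , _ , E′) inv′ R′ r≡r′ = ∣⇒∣ᵤ x≡x′ , ∣⇒∣ᵤ y≡y′
    where
    x̄≡x̄′ : + c1 ∣ₛ x̄ - x̄′
    x̄≡x̄′ = ∣ₛ-transfer (+ c1) n (r - r′) (x̄ - x̄′)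
      (r-diff (+ c1) (+ c2) n r r′ x̄ x̄′ (IsR1⇒c1*r+c2≡n*x̄ x̄ r R) (IsR1⇒c1*r+c2≡n*x̄ x̄′ r′ R′))
      (∣ᵤ⇒∣ r≡r′)
    x≡x′ : + c1 ∣ₛ x - x′
    x≡x′ = inverse-unique (+ c1) x̄ x x̄′ x′
      (inverse-comm (+ c1) x x̄ (∣ᵤ⇒∣ inv)) (inverse-comm (+ c1) x′ x̄′ (∣ᵤ⇒∣ inv′)) x̄≡x̄′
    y≡y′ : + c2 ∣ₛ y - y′
    y≡y′ = ∣ₛ-transfer (+ c2) (+ c1) (x′ - x) (y - y′) (y-diff (+ c1) (+ c2) n x y x′ y′ E E′)
      (∣ᵤ⇒∣ (Cong-sym x x′ (+ c1) (∣⇒∣ᵤ x≡x′)))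

  r₁-surjective : (r : ℤ) → InY c1 c2 n r →
                  Σ[ x ∈ ℤ ] Σ[ y ∈ ℤ ] Σ[ x̄ ∈ ℤ ] Σ[ r₁ ∈ ℤ ]
                    (InX c1 c2 n x y × IsInvMod c1 x x̄ × IsR1 c1 c2 n x̄ r₁ × Cong r₁ r n)
  r₁-surjective r (gcd[r,n]≡1 , cong-mod-n/d , minimal) =
    x , y , w , r ,
    (coprime⇒gcd≡1 x (+ c1) (invertible⇒coprime (+ c1) x w inv) ,
     coprime⇒gcd≡1 y (+ c2) coprime[y,c2] ,
     rx-nt-solves (+ c1) (+ c2) n x w t r I R⁺) ,
    ∣⇒∣ᵤ inv , from (i≡j-k⇔i+k≡j (+ c1 * r) (n * w) (+ c2)) R⁺ , Cong-refl r n
    where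
    m∣Ar+B : m ∣ₛ A * r + B
    m∣Ar+B = to (Cong-mod-n/d⇔m∣ (A * r + B)) cong-mod-n/d
    w : ℤ
    w = Signed.quotient m∣Ar+B
    reduced : A * r + B ≡ m * w
    reduced = trans (Signed._∣_.equality m∣Ar+B) (ℤP.*-comm w m)
    R⁺ : + c1 * r + + c2 ≡ n * w
    R⁺ = from (related⇔reduced r w) reduced
    inverse : Σ[ x ∈ ℤ ] + c1 ∣ₛ x * w - 1ℤ
    inverse = coprime⇒invertible w c1
      (coprime[w,d]⇒coprime[w,c1] r w R⁺ (to (minimal⇔coprime r w reduced) minimal))
    x : ℤ
    x = proj₁ inverse
    inv : + c1 ∣ₛ x * w - 1ℤ
    inv = proj₂ inverse
    t : ℤ
    t = Signed.quotient inv
    I : x * w - 1ℤ ≡ t * + c1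
    I = Signed._∣_.equality inv
    y : ℤ
    y = r * x - n * t
    coprime[y,c2] : Coprime y (+ c2)
    coprime[y,c2] = to (coprime[r,n]⇔coprime[y,c₂] (+ c1) (+ c2) n x w t r I R⁺)
      (gcd≡1⇒coprime r n gcd[r,n]≡1)

proposition6p5 :
    (c1 c2 : ℕ) → .{{_ : NonZero c1}} → .{{_ : NonZero c2}} →
    (n : ℤ) → .{{_ : Data.Integer.NonZero n}} →
    (+ gcd c1 c2) ∣ n →
      -- r1 = (n xbar - c2) / c1 is an integer
      ((x y xbar : ℤ) → InX c1 c2 n x y → IsInvMod c1 x xbar →
         Σ[ r1 ∈ ℤ ] IsR1 c1 c2 n xbar r1)
      -- its class mod n depends only on the class of (x , y) (and not on the choice of xbar)
      × ((x y xbar r1 x' y' xbar' r1' : ℤ) →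
           InX c1 c2 n x y → IsInvMod c1 x xbar → IsR1 c1 c2 n xbar r1 →
           InX c1 c2 n x' y' → IsInvMod c1 x' xbar' → IsR1 c1 c2 n xbar' r1' →
           XEquiv c1 c2 x y x' y' → Cong r1 r1' n)
      -- i maps X(c1,c2,n) into Y(c1,c2,n)
      × ((x y xbar r1 : ℤ) →
           InX c1 c2 n x y → IsInvMod c1 x xbar → IsR1 c1 c2 n xbar r1 →
           InY c1 c2 n r1)
      -- i is injective on classes
      × ((x y xbar r1 x' y' xbar' r1' : ℤ) →
           InX c1 c2 n x y → IsInvMod c1 x xbar → IsR1 c1 c2 n xbar r1 →
           InX c1 c2 n x' y' → IsInvMod c1 x' xbar' → IsR1 c1 c2 n xbar' r1' →
           Cong r1 r1' n → XEquiv c1 c2 x y x' y')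
      -- i is onto Y(c1,c2,n)
      × ((r : ℤ) → InY c1 c2 n r →
           Σ[ x ∈ ℤ ] Σ[ y ∈ ℤ ] Σ[ xbar ∈ ℤ ] Σ[ r1 ∈ ℤ ]
             (InX c1 c2 n x y × IsInvMod c1 x xbar × IsR1 c1 c2 n xbar r1 × Cong r1 r n))
proposition6p5 c1 c2 n d∣n = r₁-exists , r₁-respects-~ , r₁∈Y , r₁-injective , r₁-surjective
  where open Correspondence c1 c2 n d∣n
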